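{- Let $q,k,\ell$ be positive integers with $\ell\le k$. Then \[\mathcal{E}(q,2k,2\ell)\geq\left\lfloor\frac{k}{2}\right\rfloor\mathcal{E}(q,k,\ell)^2.\]
   Context: Let $q,k,\ell$ be positive integers with $\ell\le k$. A colouring of $n$ eBugs is an $n$-tuple of words $w_1,\dots,w_n\in\mathbb{Z}_q^k$ (positions read modulo $k$). It is $\ell$-valid if the $nk$ cyclic windows $(w_j(i),\dots,w_j(i+\ell-1))\in\mathbb{Z}_q^\ell$ (positions modulo $k$), for $1\le j\le n$, $0\le i<k$, are pairwise distinct. The eBug number $\mathcal{E}(q,k,\ell)$ is the maximum $n$ for which an $\ell$-valid colouring of $n$ eBugs exists. -}

module Defs where

open import Data.Nat using (ℕ; zero; suc; _+_; _*_; _≤_; NonZero)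
open import Data.Nat.DivMod using (_%_)
open import Data.Fin using (Fin; toℕ; fromℕ<)
open import Data.Nat.DivMod using (m%n<n)
open import Data.Product using (_×_; _,_; Σ)
open import Relation.Binary.PropositionalEquality using (_≡_)

Word : ℕ → ℕ → Set
Word q k = Fin k → Fin q

Colouring : ℕ → ℕ → ℕ → Set
Colouring q k n = Fin n → Word q k

window : ∀ {q k} .{{_ : NonZero k}} (ℓ : ℕ) → Word q k → Fin k → (Fin ℓ → Fin q)
window {k = k} ℓ w i t = w (fromℕ< (m%n<n (toℕ i + toℕ t) k))

Valid : ∀ {q k n} .{{_ : NonZero k}} (ℓ : ℕ) → Colouring q k n → Set
Valid {k = k} {n = n} ℓ c =
  (j j' : Fin n) (i i' : Fin k) →
  (∀ t → window ℓ (c j) i t ≡ window ℓ (c j') i' t) →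
  (j ≡ j') × (i ≡ i')

IsEBugNumber : (q k ℓ : ℕ) .{{_ : NonZero k}} → ℕ → Set
IsEBugNumber q k ℓ E =
  Σ (Colouring q k E) (λ c → Valid ℓ c) ×
  (∀ n (c : Colouring q k n) → Valid ℓ c → n ≤ E)

-- Interleave two words u, v of a valid colouring as u₀ v_σ u₁ v_{σ+1} … for a
-- shift 1 ≤ σ ≤ ⌊k/2⌋.  A 2ℓ-window of such a word interleaves an ℓ-window of
-- u with one of v, so by validity of the original colouring it determines u, v
-- and the offsets of both ℓ-windows modulo k.  For a window starting at an even
-- position these offsets differ by σ, for an odd one by 1 − σ; a coincidence
-- between the two kinds would give σ + σ′ ≡ 1 (mod k), impossible as
-- 2 ≤ σ + σ′ ≤ k.  Hence the ⌊k/2⌋ E² interleaved words form a 2ℓ-valid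
-- colouring of length 2k.
module Submission where

open import Defs
open import Data.Nat using (ℕ; zero; suc; _+_; _*_; _≤_; _<_; _/_; _%_; NonZero; s≤s; z≤n)
open import Data.Nat.Properties
open import Data.Nat.DivMod
open import Data.Fin using (Fin; toℕ; fromℕ<)
open import Data.Fin.Properties using (toℕ-fromℕ<; fromℕ<-cong; fromℕ<-injective; toℕ-injective; toℕ<n; *↔×)
open import Data.Product using (_×_; _,_; proj₁; proj₂; map₁)
open import Data.Product.Function.NonDependent.Propositional using (_×-↔_)
open import Data.Sum using (inj₁; inj₂)
open import Data.Empty using (⊥; ⊥-elim)
open import Function using (_∘_; _↔_; Injection; Inverse)
open import Function.Properties.Inverse using (↔-refl; ↔-trans; ↔⇒↣)
open import Relation.Binary.PropositionalEquality

+-%-congʳ : ∀ {a b} c k .{{_ : NonZero k}} → a % k ≡ b % k → (a + c) % k ≡ (b + c) % k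
+-%-congʳ {a} {b} c k eq = begin
  (a + c) % k          ≡⟨ %-distribˡ-+ a c k ⟩
  (a % k + c % k) % k  ≡⟨ cong (λ x → (x + c % k) % k) eq ⟩
  (b % k + c % k) % k  ≡⟨ %-distribˡ-+ b c k ⟨
  (b + c) % k          ∎
  where open ≡-Reasoning

+-%-congˡ : ∀ c {a b} k .{{_ : NonZero k}} → a % k ≡ b % k → (c + a) % k ≡ (c + b) % k
+-%-congˡ c {a} {b} k eq = begin
  (c + a) % k  ≡⟨ %-congˡ (+-comm c a) ⟩
  (a + c) % k  ≡⟨ +-%-congʳ c k eq ⟩
  (b + c) % k  ≡⟨ %-congˡ (+-comm b c) ⟩
  (c + b) % k  ∎
  where open ≡-Reasoning

-- Adding c * (k - 1) turns + c into + c * k, which vanishes modulo k.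
+-%-cancelʳ : ∀ {a b} c k .{{_ : NonZero k}} → (a + c) % k ≡ (b + c) % k → a % k ≡ b % k
+-%-cancelʳ {a} {b} c k@(suc k′) eq = begin
  a % k                 ≡⟨ [m+kn]%n≡m%n a c k ⟨
  (a + c * k) % k       ≡⟨ %-congˡ (absorb a) ⟩
  (a + c + c * k′) % k  ≡⟨ +-%-congʳ {a + c} {b + c} (c * k′) k eq ⟩
  (b + c + c * k′) % k  ≡⟨ %-congˡ (absorb b) ⟨
  (b + c * k) % k       ≡⟨ [m+kn]%n≡m%n b c k ⟩
  b % k                 ∎
  where
  open ≡-Reasoning
  absorb : ∀ x → x + c * k ≡ x + c + c * k′
  absorb x = trans (cong (x +_) (*-suc c k′)) (sym (+-assoc x c (c * k′)))

+-%-cancelˡ : ∀ c {a b} k .{{_ : NonZero k}} → (c + a) % k ≡ (c + b) % k → a % k ≡ b % k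
+-%-cancelˡ c {a} {b} k eq =
  +-%-cancelʳ c k (trans (%-congˡ (+-comm a c)) (trans eq (%-congˡ (+-comm c b))))

[n+m]%n≡m%n : ∀ m n .{{_ : NonZero n}} → (n + m) % n ≡ m % n
[n+m]%n≡m%n m n = trans (%-congˡ (+-comm n m)) ([m+n]%n≡m%n m n)

<⇒%-injective : ∀ {m o} n .{{_ : NonZero n}} → m < n → o < n → m % n ≡ o % n → m ≡ o
<⇒%-injective n m<n o<n eq = trans (sym (m<n⇒m%n≡m m<n)) (trans eq (m<n⇒m%n≡m o<n))

m%n≢1%n : ∀ {m} n .{{_ : NonZero n}} → 2 ≤ m → m ≤ n → m % n ≢ 1 % n
m%n≢1%n n 2≤m m≤n eq with m≤n⇒m<n∨m≡n m≤n
... | inj₁ m<n = <⇒≢ 2≤m (sym (trans (sym (m<n⇒m%n≡m m<n)) (trans eq 1%n≡1)))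
  where 1%n≡1 = m<n⇒m%n≡m (≤-trans 2≤m (<⇒≤ m<n))
... | inj₂ refl = 0≢1+n (trans (sym (n%n≡0 n)) (trans eq (m<n⇒m%n≡m 2≤m)))

module _ {a} {A : Set a} where

  Periodic : ℕ → (ℕ → A) → Set a
  Periodic p h = ∀ n → h (p + n) ≡ h n

  periodic-* : ∀ {p h} → Periodic p h → ∀ x n → h (x * p + n) ≡ h n
  periodic-*             per zero    n = refl
  periodic-* {p} {h} per (suc x) n =
    trans (cong h (+-assoc p (x * p) n)) (trans (per _) (periodic-* per x n))

  periodic-% : ∀ {p h} .{{_ : NonZero p}} → Periodic p h → ∀ n → h (n % p) ≡ h n
  periodic-% {p} {h} per n = sym (begin
    h n                    ≡⟨ cong h (m≡m%n+[m/n]*n n p) ⟩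
    h (n % p + n / p * p)  ≡⟨ cong h (+-comm (n % p) _) ⟩
    h (n / p * p + n % p)  ≡⟨ periodic-* per (n / p) (n % p) ⟩
    h (n % p)              ∎)
    where open ≡-Reasoning

  cyclic : ∀ {k} .{{_ : NonZero k}} → (Fin k → A) → ℕ → A
  cyclic {k} w n = w (fromℕ< (m%n<n n k))

  cyclic-cong : ∀ {k} .{{_ : NonZero k}} (w : Fin k → A) {m n} → m % k ≡ n % k → cyclic w m ≡ cyclic w n
  cyclic-cong w eq = cong w (fromℕ<-cong _ _ eq _ _)

  cyclic-periodic : ∀ {k} .{{_ : NonZero k}} (w : Fin k → A) → Periodic k (cyclic w)
  cyclic-periodic {k} w n = cyclic-cong w ([n+m]%n≡m%n n k)

  -- interleave f g = f 0, g 0, f 1, g 1, …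
  interleave : (ℕ → A) → (ℕ → A) → ℕ → A
  interleave f g zero    = f zero
  interleave f g (suc n) = interleave g (f ∘ suc) n

  interleave-even : ∀ f g i → interleave f g (i * 2) ≡ f i
  interleave-even f g zero    = refl
  interleave-even f g (suc i) = interleave-even (f ∘ suc) (g ∘ suc) i

  interleave-odd : ∀ f g i → interleave f g (suc (i * 2)) ≡ g i
  interleave-odd f g = interleave-even g (f ∘ suc)

  interleave-shift : ∀ f g i n →
    interleave f g (i * 2 + n) ≡ interleave (λ j → f (i + j)) (λ j → g (i + j)) n
  interleave-shift f g zero    n = refl
  interleave-shift f g (suc i) n = interleave-shift (f ∘ suc) (g ∘ suc) i n

  interleave-cong : ∀ {f g f′ g′} → (∀ j → f j ≡ f′ j) → (∀ j → g j ≡ g′ j) →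
    ∀ n → interleave f g n ≡ interleave f′ g′ n
  interleave-cong f≗f′ g≗g′ zero    = f≗f′ zero
  interleave-cong f≗f′ g≗g′ (suc n) = interleave-cong g≗g′ (f≗f′ ∘ suc) n

  interleave-periodic : ∀ {p f g} → Periodic p f → Periodic p g → Periodic (2 * p) (interleave f g)
  interleave-periodic {p} {f} {g} perf perg n = begin
    interleave f g (2 * p + n)                             ≡⟨ cong (λ m → interleave f g (m + n)) (*-comm 2 p) ⟩
    interleave f g (p * 2 + n)                             ≡⟨ interleave-shift f g p n ⟩
    interleave (λ j → f (p + j)) (λ j → g (p + j)) n       ≡⟨ interleave-cong perf perg n ⟩
    interleave f g n                                       ∎
    where open ≡-Reasoning

  interleave-prefix : ∀ {f g f′ g′} ℓ → (∀ n → n < 2 * ℓ → interleave f g n ≡ interleave f′ g′ n) →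
    (∀ r → r < ℓ → f r ≡ f′ r) × (∀ r → r < ℓ → g r ≡ g′ r)
  interleave-prefix {f} {g} {f′} {g′} ℓ eq =
    (λ r r<ℓ → begin
      f r                        ≡⟨ interleave-even f g r ⟨
      interleave f g (r * 2)     ≡⟨ eq _ (<⇒≤ (odd< r<ℓ)) ⟩
      interleave f′ g′ (r * 2)   ≡⟨ interleave-even f′ g′ r ⟩
      f′ r                       ∎) ,
    (λ r r<ℓ → begin
      g r                             ≡⟨ interleave-odd f g r ⟨
      interleave f g (suc (r * 2))    ≡⟨ eq _ (odd< r<ℓ) ⟩
      interleave f′ g′ (suc (r * 2))  ≡⟨ interleave-odd f′ g′ r ⟩
      g′ r                            ∎)
    where
    open ≡-Reasoning
    odd< : ∀ {r} → r < ℓ → suc (r * 2) < 2 * ℓ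
    odd< r<ℓ = ≤-trans (*-monoˡ-≤ 2 r<ℓ) (≤-reflexive (*-comm ℓ 2))

window-periodic : ∀ {q n} .{{_ : NonZero n}} {h : ℕ → Fin q} ℓ → Periodic n h →
  ∀ i t → window ℓ (h ∘ toℕ) i t ≡ h (toℕ i + toℕ t)
window-periodic {n = n} {h} ℓ per i t =
  trans (cong h (toℕ-fromℕ< (m%n<n (toℕ i + toℕ t) n))) (periodic-% per _)

data Halving : ℕ → Set where
  even : ∀ i → Halving (i * 2)
  odd  : ∀ i → Halving (suc (i * 2))

halving : ∀ n → Halving n
halving zero          = even 0
halving (suc zero)    = odd 0
halving (suc (suc n)) with halving n
... | even i = even (suc i)
... | odd i  = odd (suc i)

half-< : ∀ {i k} → i * 2 < 2 * k → i < k
half-< {i} {k} lt = *-cancelʳ-< 2 i k (<-≤-trans lt (≤-reflexive (*-comm 2 k)))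

index↔ : ∀ {m n} → Fin (m * (n * n)) ↔ (Fin m × Fin n × Fin n)
index↔ = ↔-trans *↔× (↔-refl ×-↔ *↔×)

module Interleaved {q k ℓ E} .{{_ : NonZero k}} (c : Colouring q k E) (valid : Valid ℓ c) where

  instance
    2k≢0 : NonZero (2 * k)
    2k≢0 = m*n≢0 2 k

  Start : Set
  Start = Fin E × ℕ

  readFrom : Start → ℕ → Fin q
  readFrom (j , a) r = cyclic (c j) (a + r)

  _≈_ : Start → Start → Set
  (j , a) ≈ (j′ , a′) = j ≡ j′ × a % k ≡ a′ % k

  readFrom-injective : ∀ x y → (∀ r → r < ℓ → readFrom x r ≡ readFrom y r) → x ≈ y
  readFrom-injective (j , a) (j′ , a′) eq with valid j j′ (start a) (start a′) windows-equal
    where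
    start : ℕ → Fin k
    start a = fromℕ< (m%n<n a k)
    readFrom-start : ∀ j a t → window ℓ (c j) (start a) t ≡ readFrom (j , a) (toℕ t)
    readFrom-start j a t = cyclic-cong (c j)
      (trans (%-congˡ (cong (_+ toℕ t) (toℕ-fromℕ< (m%n<n a k)))) (+-%-congʳ (toℕ t) k (m%n%n≡m%n a k)))
    windows-equal : ∀ t → window ℓ (c j) (start a) t ≡ window ℓ (c j′) (start a′) t
    windows-equal t = trans (readFrom-start j a t)
      (trans (eq (toℕ t) (toℕ<n t)) (sym (readFrom-start j′ a′ t)))
  ... | j≡j′ , starts≡ = j≡j′ , fromℕ<-injective _ _ _ _ starts≡

  shift : Fin (k / 2) → ℕ
  shift s = suc (toℕ s)

  shift-< : ∀ s → shift s < k
  shift-< s = ≤-<-trans (toℕ<n s) (m/n<m k 2 (s≤s (s≤s z≤n)))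

  shift+shift≤k : ∀ s s′ → shift s + shift s′ ≤ k
  shift+shift≤k s s′ = begin
    shift s + shift s′  ≤⟨ +-mono-≤ (toℕ<n s) (toℕ<n s′) ⟩
    k / 2 + k / 2       ≡⟨ cong (k / 2 +_) (+-identityʳ (k / 2)) ⟨
    2 * (k / 2)         ≡⟨ *-comm 2 (k / 2) ⟩
    k / 2 * 2           ≤⟨ m/n*n≤m k 2 ⟩
    k                   ∎
    where open ≤-Reasoning

  interleaving : Fin E → Fin E → Fin (k / 2) → ℕ → Fin q
  interleaving u v s = interleave (cyclic (c u)) (λ j → cyclic (c v) (shift s + j))

  interleaving-periodic : ∀ u v s → Periodic (2 * k) (interleaving u v s)
  interleaving-periodic u v s = interleave-periodic (cyclic-periodic (c u))
    (λ n → cyclic-cong (c v) (+-%-congˡ (shift s) k ([n+m]%n≡m%n n k)))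

  reading : Fin E → Fin E → Fin (k / 2) → ∀ {P} → Halving P → Start × Start
  reading u v s (even i) = (u , i) , (v , shift s + i)
  reading u v s (odd i)  = (v , shift s + i) , (u , suc i)

  interleaving-reading : ∀ u v s {P} (h : Halving P) n →
    interleaving u v s (P + n) ≡
    interleave (readFrom (proj₁ (reading u v s h))) (readFrom (proj₂ (reading u v s h))) n
  interleaving-reading u v s (even i) n =
    trans (interleave-shift _ _ i n) (interleave-cong (λ _ → refl) shift-assoc n)
    where shift-assoc = λ r → cong (cyclic (c v)) (sym (+-assoc (shift s) i r))
  interleaving-reading u v s (odd i) n =
    trans (interleave-shift _ _ i n) (interleave-cong shift-assoc (λ _ → refl) n)
    where shift-assoc = λ r → cong (cyclic (c v)) (sym (+-assoc (shift s) i r))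

  WindowsAgree : Fin E → Fin E → Fin (k / 2) → ℕ → Fin E → Fin E → Fin (k / 2) → ℕ → Set
  WindowsAgree u v s P u′ v′ s′ P′ =
    ∀ n → n < 2 * ℓ → interleaving u v s (P + n) ≡ interleaving u′ v′ s′ (P′ + n)

  readings-agree : ∀ {u v s P u′ v′ s′ P′} → WindowsAgree u v s P u′ v′ s′ P′ →
    (h : Halving P) (h′ : Halving P′) →
    proj₁ (reading u v s h) ≈ proj₁ (reading u′ v′ s′ h′) ×
    proj₂ (reading u v s h) ≈ proj₂ (reading u′ v′ s′ h′)
  readings-agree {u} {v} {s} {u′ = u′} {v′} {s′} eq h h′ =
    readFrom-injective _ _ (proj₁ readFroms-agree) , readFrom-injective _ _ (proj₂ readFroms-agree)
    where
    readFroms-agree = interleave-prefix ℓ λ n lt →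
      trans (sym (interleaving-reading u v s h n))
        (trans (eq n lt) (interleaving-reading u′ v′ s′ h′ n))

  offsets-injective : ∀ {i i′} s s′ → i < k → i′ < k → i % k ≡ i′ % k →
    (shift s + i) % k ≡ (shift s′ + i′) % k → i ≡ i′ × s ≡ s′
  offsets-injective {i} s s′ i<k i′<k i≈i′ shifts≈ with <⇒%-injective k i<k i′<k i≈i′
  ... | refl = refl , toℕ-injective (suc-injective
    (<⇒%-injective k (shift-< s) (shift-< s′) (+-%-cancelʳ i k shifts≈)))

  mixed-parity-impossible : ∀ {i i′} s s′ → i % k ≡ (shift s′ + i′) % k →
    (shift s + i) % k ≡ suc i′ % k → ⊥
  mixed-parity-impossible {i} {i′} s s′ i≈ shifted≈ =
    m%n≢1%n k (+-mono-≤ (s≤s z≤n) (s≤s z≤n)) (shift+shift≤k s s′) (+-%-cancelʳ i′ k (begin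
      (shift s + shift s′ + i′) % k    ≡⟨ %-congˡ (+-assoc (shift s) (shift s′) i′) ⟩
      (shift s + (shift s′ + i′)) % k  ≡⟨ +-%-congˡ (shift s) k i≈ ⟨
      (shift s + i) % k                ≡⟨ shifted≈ ⟩
      (1 + i′) % k                     ∎))
    where open ≡-Reasoning

  placement-injective : ∀ {u v s P u′ v′ s′ P′} (h : Halving P) (h′ : Halving P′) →
    P < 2 * k → P′ < 2 * k →
    proj₁ (reading u v s h) ≈ proj₁ (reading u′ v′ s′ h′) →
    proj₂ (reading u v s h) ≈ proj₂ (reading u′ v′ s′ h′) →
    u ≡ u′ × v ≡ v′ × s ≡ s′ × P ≡ P′
  placement-injective {s = s} {s′ = s′} (even i) (even i′) P< P′< (u≡ , i≈) (v≡ , shifted≈)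
    with offsets-injective s s′ (half-< P<) (half-< P′<) i≈ shifted≈
  ... | i≡ , s≡ = u≡ , v≡ , s≡ , cong (_* 2) i≡
  placement-injective {s = s} {s′ = s′} (odd i) (odd i′) P< P′< (v≡ , shifted≈) (u≡ , suci≈)
    with offsets-injective s s′ (half-< (<-trans (n<1+n _) P<)) (half-< (<-trans (n<1+n _) P′<))
           (+-%-cancelˡ 1 k suci≈) shifted≈
  ... | i≡ , s≡ = u≡ , v≡ , s≡ , cong (suc ∘ (_* 2)) i≡
  placement-injective {s = s} {s′ = s′} (even _) (odd _) _ _ (_ , i≈) (_ , shifted≈) =
    ⊥-elim (mixed-parity-impossible s s′ i≈ shifted≈)
  placement-injective {s = s} {s′ = s′} (odd _) (even _) _ _ (_ , shifted≈) (_ , i≈) =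
    ⊥-elim (mixed-parity-impossible s′ s (sym shifted≈) (sym i≈))

  interleaving-injective : ∀ {u v s P u′ v′ s′ P′} → P < 2 * k → P′ < 2 * k →
    WindowsAgree u v s P u′ v′ s′ P′ → u ≡ u′ × v ≡ v′ × s ≡ s′ × P ≡ P′
  interleaving-injective {P = P} {P′ = P′} P< P′< eq =
    placement-injective (halving P) (halving P′) P< P′< (proj₁ agree) (proj₂ agree)
    where agree = readings-agree eq (halving P) (halving P′)

  interleavedWord : Fin (k / 2) × Fin E × Fin E → Word q (2 * k)
  interleavedWord (s , u , v) = interleaving u v s ∘ toℕ

  interleavedWord-injective : ∀ x x′ p p′ →
    (∀ t → window (2 * ℓ) (interleavedWord x) p t ≡ window (2 * ℓ) (interleavedWord x′) p′ t) →
    x ≡ x′ × p ≡ p′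
  interleavedWord-injective (s , u , v) (s′ , u′ , v′) p p′ eq
    with interleaving-injective (toℕ<n p) (toℕ<n p′) windows-agree
    where
    windows-agree : WindowsAgree u v s (toℕ p) u′ v′ s′ (toℕ p′)
    windows-agree n n< = begin
      interleaving u v s (toℕ p + n)           ≡⟨ cong (λ m → interleaving u v s (toℕ p + m)) (toℕ-fromℕ< n<) ⟨
      interleaving u v s (toℕ p + toℕ t)       ≡⟨ window-periodic (2 * ℓ) (interleaving-periodic u v s) p t ⟨
      window (2 * ℓ) (interleavedWord (s , u , v)) p t      ≡⟨ eq t ⟩
      window (2 * ℓ) (interleavedWord (s′ , u′ , v′)) p′ t  ≡⟨ window-periodic (2 * ℓ) (interleaving-periodic u′ v′ s′) p′ t ⟩
      interleaving u′ v′ s′ (toℕ p′ + toℕ t)   ≡⟨ cong (λ m → interleaving u′ v′ s′ (toℕ p′ + m)) (toℕ-fromℕ< n<) ⟩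
      interleaving u′ v′ s′ (toℕ p′ + n)       ∎
      where
      open ≡-Reasoning
      t = fromℕ< n<
  ... | refl , refl , refl , P≡ = refl , toℕ-injective P≡

  interleavedColouring : Colouring q (2 * k) (k / 2 * (E * E))
  interleavedColouring = interleavedWord ∘ Inverse.to index↔

  interleavedColouring-valid : Valid (2 * ℓ) interleavedColouring
  interleavedColouring-valid x x′ p p′ eq =
    map₁ (Injection.injective (↔⇒↣ index↔)) (interleavedWord-injective _ _ p p′ eq)

theorem6 : (q k ℓ : ℕ) → 1 ≤ q → 1 ≤ ℓ → ℓ ≤ k → .{{nz : NonZero k}} →
    (E E′ : ℕ) → IsEBugNumber q k ℓ E →
    IsEBugNumber q (2 * k) (2 * ℓ) {{m*n≢0 2 k}} E′ →
    (k / 2) * (E * E) ≤ E′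
theorem6 q k ℓ _ _ _ E E′ ((c , valid) , _) (_ , maximal) =
  maximal (k / 2 * (E * E)) interleavedColouring interleavedColouring-valid
  where open Interleaved c valid
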